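{- Let $G$ be a graph and let $\ell$ be a $2$-intersecting supermodular weakly subadditive nonnegative integer-valued function on subsets of $V(G)$. Suppose that $d_G(v)\ge 2\ell(v)$ for each vertex $v$, and that for any two disjoint vertex sets $A$ and $B$ with $A\cup B\subsetneq V(G)$ and $e_G(A\cup B)>\sum_{v\in A\cup B}\ell(v)-\ell(A\cup B)$, $$d_{G-B}(A)\ge 2\ell(A\cup B)-\sum_{v\in B}\ell(v).$$ Then for every edge set $M\subseteq E(G)$ with $|M|\le\ell(V(G))$, $G$ has a spanning $\ell$-rigid subgraph $H$ with $E(H)\cap M=\emptyset$.
   Context: Graphs are finite, loopless, multiple edges allowed. $d_G(X)$ (resp. $d_{G-B}(A)$) is the number of edges of $G$ (resp. $G-B$) with exactly one end in $X$ (resp. $A$); $e_G(X)$ is the number of edges with both ends in $X$. Set functions are zero on $\emptyset$, $\ell(v)=\ell(\{v\})$. $\ell$ is $2$-intersecting supermodular if $\ell(A\cap B)+\ell(A\cup B)\ge\ell(A)+\ell(B)$ whenever $|A\cap B|\ge 2$; weakly subadditive if $\sum_{v\in A}\ell(v)\ge\ell(A)$ for all $A$. A graph $H$ is $\ell$-rigid if it has a spanning subgraph $F$ with $e_F(X)\le\sum_{v\in X}\ell(v)-\ell(X)$ for all $X\subseteq V(H)$ and $|E(F)|=\sum_{v\in V(H)}\ell(v)-\ell(V(H))$. -}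

module Defs where

open import Data.Nat using (ℕ; zero; suc; _+_; _*_; _≤_; _<_)
open import Data.Bool using (Bool; true; false; if_then_else_; _∧_; _∨_; not; _xor_)
open import Data.Fin using (Fin)
open import Data.Fin.Subset using (Subset; _∈_; _∉_; _⊆_; _∩_; _∪_; ∣_∣; ⁅_⁆; ⊥; ⊤)
open import Data.Vec using (lookup)
open import Data.Product using (Σ; _×_; proj₁; proj₂; ∃)
open import Relation.Binary.PropositionalEquality using (_≡_; _≢_)

record Graph : Set where
  field
    n     : ℕ
    m     : ℕ
    ends  : Fin m → Fin n × Fin n
    loopless : ∀ e → proj₁ (ends e) ≢ proj₂ (ends e)

open Graph public

VSet : Graph → Set
VSet G = Subset (n G)

ESet : Graph → Set
ESet G = Subset (m G)

count : ∀ {k} → (Fin k → Bool) → ℕ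
count {zero}  p = 0
count {suc k} p = (if p Fin.zero then 1 else 0) + count (λ i → p (Fin.suc i))

mem : ∀ {k} → Subset k → Fin k → Bool
mem X x = lookup X x

end₁ end₂ : (G : Graph) → Fin (m G) → Fin (n G)
end₁ G e = proj₁ (ends G e)
end₂ G e = proj₂ (ends G e)

eIn : (G : Graph) → ESet G → VSet G → ℕ
eIn G S X = count (λ e → mem S e ∧ (mem X (end₁ G e) ∧ mem X (end₂ G e)))

dIn : (G : Graph) → ESet G → VSet G → ℕ
dIn G S X = count (λ e → mem S e ∧ (mem X (end₁ G e) xor mem X (end₂ G e)))

dMinus : (G : Graph) → VSet G → VSet G → ℕ
dMinus G B A = count (λ e → not (mem B (end₁ G e) ∨ mem B (end₂ G e))
                            ∧ (mem A (end₁ G e) xor mem A (end₂ G e)))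

sumSingle : ∀ {k} → (Subset k → ℕ) → Subset k → ℕ
sumSingle ℓ X = count' (λ v → if mem X v then ℓ ⁅ v ⁆ else 0)
  where
  count' : ∀ {j} → (Fin j → ℕ) → ℕ
  count' {zero}  f = 0
  count' {suc j} f = f Fin.zero + count' (λ i → f (Fin.suc i))

TwoIntersectingSupermodular : ∀ {k} → (Subset k → ℕ) → Set
TwoIntersectingSupermodular ℓ =
  ∀ A B → 2 ≤ ∣ A ∩ B ∣ → ℓ A + ℓ B ≤ ℓ (A ∩ B) + ℓ (A ∪ B)

WeaklySubadditive : ∀ {k} → (Subset k → ℕ) → Set
WeaklySubadditive ℓ = ∀ A → ℓ A ≤ sumSingle ℓ A

-- H (an edge set, spanning) is ℓ-rigid: there is F ⊆ H with
-- e_F(X) ≤ Σ_{v∈X} ℓ(v) − ℓ(X) for all X and |F| = Σ_{v∈V} ℓ(v) − ℓ(V)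
-- (subtractions moved to the other side; they are nonnegative under weak subadditivity).
IsRigid : (G : Graph) → (VSet G → ℕ) → ESet G → Set
IsRigid G ℓ H =
  Σ (ESet G) λ F → F ⊆ H
    × (∀ X → eIn G F X + ℓ X ≤ sumSingle ℓ X)
    × (∣ F ∣ + ℓ ⊤ ≡ sumSingle ℓ ⊤)

-- Grow an edge set F avoiding M greedily while keeping it ℓ-sparse, e_F(X) + ℓ(X) ≤ Σ_{v∈X} ℓ(v) for
-- all X; call X tight if equality holds. When no edge can be added, each edge outside F ∪ M is spanned
-- by a tight set, hence by a maximal one Y, which is then overfull in G. Tight sets sharing two vertices
-- have a tight union (e_F is supermodular, ℓ is 2-intersecting supermodular), so maximal tight sets
-- share at most one vertex and every edge is spanned by at most one of them. Unless V is already tight,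
-- the hypothesis applies to each such Y, with B the vertices of Y lying in another member and A the
-- rest, and the degree condition to the vertices in no member. An edge counted on the right-hand sides
-- is spanned by no member, so lies in F or in M, and is counted at most twice; double counting yields
-- Σ_v ℓ(v) ≤ |F| + |M| ≤ |F| + ℓ(V), so F already has Σ_v ℓ(v) − ℓ(V) edges.

module Submission where

open import Defs
open import Data.Nat using (ℕ; _+_; _*_; _≤_; _<_)
open import Data.Fin.Subset using (Subset; _∈_; _∉_; _⊆_; _∩_; _∪_; ∣_∣; ⁅_⁆; ⊥; ⊤)
open import Data.Product using (Σ; _×_; ∃)
open import Relation.Binary.PropositionalEquality using (_≡_)

open import Algebra.Bundles using (CommutativeMonoid)
import Algebra.Properties.CommutativeSemigroup as CommutativeSemigroupProperties
import Algebra.Properties.Semiring.Sum as SemiringSum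
open import Data.Bool.Base using (Bool; true; false; if_then_else_; _∧_; _∨_; not; _xor_)
import Data.Bool.Properties as Boolₚ
open import Data.Empty using (⊥-elim)
open import Data.Fin.Base using (Fin; zero; suc)
open import Data.Fin.Properties using (any?)
open import Data.Fin.Subset using (inside; outside; ∁; _⊂_; _⊃_; _-_)
open import Data.Fin.Subset.Induction using (⊃-wellFounded)
open import Data.Fin.Subset.Properties
open import Data.Nat.Base using (zero; suc; _∸_; z≤n; s≤s; _<ᵇ_; _≡ᵇ_)
open import Data.Nat.Properties
open import Data.Nat.Tactic.RingSolver using (solve-∀)
open import Data.Product using (_,_; proj₁; proj₂)
open import Data.Sum using (inj₁; inj₂)
open import Data.Vec.Base using ([]; _∷_; lookup; tabulate; tail; here; there)
open import Data.Vec.Properties using (lookup-zipWith; lookup-map; lookup-replicate; lookup∘tabulate; []=⇒lookup; lookup⇒[]=)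
open import Function.Base using (_∘_)
open import Function.Bundles using (Equivalence)
open import Induction.WellFounded using (Acc; acc)
open import Relation.Binary.PropositionalEquality using (refl; sym; trans; cong; cong₂; subst; subst₂; _≢_; module ≡-Reasoning)
open import Relation.Nullary using (¬_; ¬?; Dec; yes; no)
open import Relation.Nullary.Decidable using (_×-dec_; isYes; toWitness; fromWitness; decidable-stable)

open SemiringSum +-*-semiring using (sum; sum-cong-≗; sum-replicate-zero; ∑-distrib-+; ∑-comm; *-distribˡ-sum)
open CommutativeSemigroupProperties +-commutativeSemigroup using () renaming (interchange to +-interchange)
open CommutativeSemigroupProperties *-commutativeSemigroup using () renaming (x∙yz≈y∙xz to x*[y*z]≡y*[x*z])
open CommutativeSemigroupProperties (CommutativeMonoid.commutativeSemigroup Boolₚ.∧-commutativeMonoid)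
  using () renaming (interchange to ∧-interchange)

[_] : Bool → ℕ
[ b ] = if b then 1 else 0

[b]≤1 : ∀ b → [ b ] ≤ 1
[b]≤1 true  = ≤-refl
[b]≤1 false = z≤n

[x]≤[y] : ∀ {x y} → (x ≡ true → y ≡ true) → [ x ] ≤ [ y ]
[x]≤[y] {false}        x⇒y = z≤n
[x]≤[y] {true} {true}  x⇒y = ≤-refl
[x]≤[y] {true} {false} x⇒y with () ← x⇒y refl

[x]+[y]≡[x∧y]+[x∨y] : ∀ x y → [ x ] + [ y ] ≡ [ x ∧ y ] + [ x ∨ y ]
[x]+[y]≡[x∧y]+[x∨y] true  true  = refl
[x]+[y]≡[x∧y]+[x∨y] true  false = refl
[x]+[y]≡[x∧y]+[x∨y] false true  = refl
[x]+[y]≡[x∧y]+[x∨y] false false = refl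

[x∧y]≡[x]*[y] : ∀ x y → [ x ∧ y ] ≡ [ x ] * [ y ]
[x∧y]≡[x]*[y] true  y = sym (+-identityʳ [ y ])
[x∧y]≡[x]*[y] false y = refl

[x∧[y∧z]]≡[y]*[x∧z] : ∀ x y z → [ x ∧ (y ∧ z) ] ≡ [ y ] * [ x ∧ z ]
[x∧[y∧z]]≡[y]*[x∧z] false y z = sym (*-zeroʳ [ y ])
[x∧[y∧z]]≡[y]*[x∧z] true true  z = sym (+-identityʳ [ z ])
[x∧[y∧z]]≡[y]*[x∧z] true false z = refl

[x∧[y∧z]]≡[z]*[x∧y] : ∀ x y z → [ x ∧ (y ∧ z) ] ≡ [ z ] * [ x ∧ y ]
[x∧[y∧z]]≡[z]*[x∧y] x y z = trans (cong (λ w → [ x ∧ w ]) (Boolₚ.∧-comm y z)) ([x∧[y∧z]]≡[y]*[x∧z] x z y)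

[x∧[y∧¬z]]+[x∧[y∧z]]≡[x∧y] : ∀ x y z → [ x ∧ (y ∧ not z) ] + [ x ∧ (y ∧ z) ] ≡ [ x ∧ y ]
[x∧[y∧¬z]]+[x∧[y∧z]]≡[x∧y] false y     z     = refl
[x∧[y∧¬z]]+[x∧[y∧z]]≡[x∧y] true  false z     = refl
[x∧[y∧¬z]]+[x∧[y∧z]]≡[x∧y] true  true  true  = refl
[x∧[y∧¬z]]+[x∧[y∧z]]≡[x∧y] true  true  false = refl

[p]*[[x]*l]≡l*[p∧x] : ∀ p x l → [ p ] * ([ x ] * l) ≡ l * [ p ∧ x ]
[p]*[[x]*l]≡l*[p∧x] p x l = begin
  [ p ] * ([ x ] * l) ≡⟨ *-assoc [ p ] [ x ] l ⟨
  [ p ] * [ x ] * l   ≡⟨ cong (_* l) ([x∧y]≡[x]*[y] p x) ⟨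
  [ p ∧ x ] * l       ≡⟨ *-comm [ p ∧ x ] l ⟩
  l * [ p ∧ x ]       ∎
  where open ≡-Reasoning

sum-mono-≤ : ∀ {k} {f g : Fin k → ℕ} → (∀ i → f i ≤ g i) → sum f ≤ sum g
sum-mono-≤ {zero}  f≤g = z≤n
sum-mono-≤ {suc k} f≤g = +-mono-≤ (f≤g zero) (sum-mono-≤ (f≤g ∘ suc))

sum-mono-< : ∀ {k} {f g : Fin k → ℕ} → (∀ i → f i ≤ g i) → ∀ j → f j < g j → sum f < sum g
sum-mono-< f≤g zero    f<g = +-mono-<-≤ f<g (sum-mono-≤ (f≤g ∘ suc))
sum-mono-< f≤g (suc j) f<g = +-mono-≤-< (f≤g zero) (sum-mono-< (f≤g ∘ suc) j f<g)

sum-⁅⁆ : ∀ {k} (j : Fin k) (g : Fin k → ℕ) → sum (λ i → [ lookup ⁅ j ⁆ i ] * g i) ≡ g j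
sum-⁅⁆ {suc k} zero g = begin
  g zero + 0 + sum (λ i → [ lookup ⊥ i ] * g (suc i))
    ≡⟨ cong (g zero + 0 +_) (sum-cong-≗ (λ i → cong (λ b → [ b ] * g (suc i)) (lookup-replicate i false))) ⟩
  g zero + 0 + sum {k} (λ _ → 0)
    ≡⟨ cong (g zero + 0 +_) (sum-replicate-zero k) ⟩
  g zero + 0 + 0
    ≡⟨ trans (+-identityʳ _) (+-identityʳ _) ⟩
  g zero ∎
  where open ≡-Reasoning
sum-⁅⁆ {suc k} (suc j) g = sum-⁅⁆ j (g ∘ suc)

count≡sum : ∀ {k} (p : Fin k → Bool) → count p ≡ sum ([_] ∘ p)
count≡sum {zero}  p = refl
count≡sum {suc k} p = cong ([ p zero ] +_) (count≡sum (p ∘ suc))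

∣p∣≡sum : ∀ {k} (p : Subset k) → ∣ p ∣ ≡ sum ([_] ∘ lookup p)
∣p∣≡sum []            = refl
∣p∣≡sum (inside  ∷ p) = cong suc (∣p∣≡sum p)
∣p∣≡sum (outside ∷ p) = ∣p∣≡sum p

sumSingle≡sum : ∀ {k} (ℓ : Subset k → ℕ) X → sumSingle ℓ X ≡ sum (λ v → [ lookup X v ] * ℓ ⁅ v ⁆)
sumSingle≡sum ℓ []      = refl
sumSingle≡sum ℓ (x ∷ X) = cong₂ _+_ (term x) (sumSingle≡sum (λ S → ℓ (outside ∷ S)) X)
  where
  term : ∀ x → (if x then ℓ ⁅ zero ⁆ else 0) ≡ [ x ] * ℓ ⁅ zero ⁆
  term true  = sym (+-identityʳ _)
  term false = refl

sumSingle-⊤ : ∀ {k} (ℓ : Subset k → ℕ) → sumSingle ℓ ⊤ ≡ sum (λ v → ℓ ⁅ v ⁆)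
sumSingle-⊤ ℓ = trans (sumSingle≡sum ℓ ⊤)
  (sum-cong-≗ (λ v → trans (cong (λ x → [ x ] * ℓ ⁅ v ⁆) (lookup-replicate v true)) (*-identityˡ (ℓ ⁅ v ⁆))))

sumSingle-modular : ∀ {k} (ℓ : Subset k → ℕ) X Y
                  → sumSingle ℓ X + sumSingle ℓ Y ≡ sumSingle ℓ (X ∩ Y) + sumSingle ℓ (X ∪ Y)
sumSingle-modular ℓ X Y = begin
  sumSingle ℓ X + sumSingle ℓ Y
    ≡⟨ cong₂ _+_ (sumSingle≡sum ℓ X) (sumSingle≡sum ℓ Y) ⟩
  sum (λ v → [ lookup X v ] * ℓ ⁅ v ⁆) + sum (λ v → [ lookup Y v ] * ℓ ⁅ v ⁆)
    ≡⟨ ∑-distrib-+ (λ v → [ lookup X v ] * ℓ ⁅ v ⁆) _ ⟨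
  sum (λ v → [ lookup X v ] * ℓ ⁅ v ⁆ + [ lookup Y v ] * ℓ ⁅ v ⁆)
    ≡⟨ sum-cong-≗ perVertex ⟩
  sum (λ v → [ lookup (X ∩ Y) v ] * ℓ ⁅ v ⁆ + [ lookup (X ∪ Y) v ] * ℓ ⁅ v ⁆)
    ≡⟨ ∑-distrib-+ (λ v → [ lookup (X ∩ Y) v ] * ℓ ⁅ v ⁆) _ ⟩
  sum (λ v → [ lookup (X ∩ Y) v ] * ℓ ⁅ v ⁆) + sum (λ v → [ lookup (X ∪ Y) v ] * ℓ ⁅ v ⁆)
    ≡⟨ cong₂ _+_ (sumSingle≡sum ℓ (X ∩ Y)) (sumSingle≡sum ℓ (X ∪ Y)) ⟨
  sumSingle ℓ (X ∩ Y) + sumSingle ℓ (X ∪ Y) ∎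
  where
  open ≡-Reasoning
  perVertex : ∀ v → [ lookup X v ] * ℓ ⁅ v ⁆ + [ lookup Y v ] * ℓ ⁅ v ⁆
                  ≡ [ lookup (X ∩ Y) v ] * ℓ ⁅ v ⁆ + [ lookup (X ∪ Y) v ] * ℓ ⁅ v ⁆
  perVertex v rewrite lookup-zipWith _∧_ v X Y | lookup-zipWith _∨_ v X Y
    | sym (*-distribʳ-+ (ℓ ⁅ v ⁆) [ lookup X v ] [ lookup Y v ])
    | sym (*-distribʳ-+ (ℓ ⁅ v ⁆) [ lookup X v ∧ lookup Y v ] [ lookup X v ∨ lookup Y v ])
    = cong (_* ℓ ⁅ v ⁆) ([x]+[y]≡[x∧y]+[x∨y] (lookup X v) (lookup Y v))

lookup≡false⇒∉ : ∀ {k} {p : Subset k} {x} → lookup p x ≡ false → x ∉ p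
lookup≡false⇒∉ px≡false x∈p = Boolₚ.not-¬ ([]=⇒lookup x∈p) px≡false

lookup-⁅⁆-sym : ∀ {k} (u v : Fin k) → lookup ⁅ u ⁆ v ≡ lookup ⁅ v ⁆ u
lookup-⁅⁆-sym zero    zero    = refl
lookup-⁅⁆-sym zero    (suc v) = lookup-replicate v false
lookup-⁅⁆-sym (suc u) zero    = sym (lookup-replicate u false)
lookup-⁅⁆-sym (suc u) (suc v) = lookup-⁅⁆-sym u v

two≤∣p∣ : ∀ {k} {p : Subset k} {u v} → u ≢ v → u ∈ p → v ∈ p → 2 ≤ ∣ p ∣
two≤∣p∣ {p = p} {u} {v} u≢v u∈p v∈p = begin
  2                 ≡⟨ cong suc (∣⁅x⁆∣≡1 v) ⟨
  suc ∣ ⁅ v ⁆ ∣     ≤⟨ s≤s (p⊆q⇒∣p∣≤∣q∣ ⁅v⁆⊆p-u) ⟩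
  suc ∣ p - u ∣     ≤⟨ x∈p⇒∣p-x∣<∣p∣ u∈p ⟩
  ∣ p ∣             ∎
  where
  open ≤-Reasoning
  ⁅v⁆⊆p-u : ⁅ v ⁆ ⊆ p - u
  ⁅v⁆⊆p-u w∈⁅v⁆ rewrite x∈⁅y⁆⇒x≡y v w∈⁅v⁆ = x∈p∧x≢y⇒x∈p-y v∈p (u≢v ∘ sym)

∣p∪⁅x⁆∣≡1+∣p∣ : ∀ {k} {p : Subset k} {x} → x ∉ p → ∣ p ∪ ⁅ x ⁆ ∣ ≡ suc ∣ p ∣
∣p∪⁅x⁆∣≡1+∣p∣ {p = inside  ∷ p} {zero}  x∉p = ⊥-elim (x∉p here)
∣p∪⁅x⁆∣≡1+∣p∣ {p = outside ∷ p} {zero}  x∉p = cong (λ q → suc ∣ q ∣) (∪-identityʳ p)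
∣p∪⁅x⁆∣≡1+∣p∣ {p = inside  ∷ p} {suc x} x∉p = cong suc (∣p∪⁅x⁆∣≡1+∣p∣ (x∉p ∘ there))
∣p∪⁅x⁆∣≡1+∣p∣ {p = outside ∷ p} {suc x} x∉p = ∣p∪⁅x⁆∣≡1+∣p∣ (x∉p ∘ there)

⊆-maximal : ∀ {k} {P : Subset k → Set} → (∀ X → Dec (P X)) → ∀ {X} → P X
          → ∃ λ Y → X ⊆ Y × P Y × (∀ Z → P Z → ¬ Y ⊂ Z)
⊆-maximal {P = P} P? {X} pX = go pX (⊃-wellFounded X)
  where
  go : ∀ {X} → P X → Acc _⊃_ X → ∃ λ Y → X ⊆ Y × P Y × (∀ Z → P Z → ¬ Y ⊂ Z)
  go {X} pX (acc larger) with anySubset? (λ Z → P? Z ×-dec X ⊂? Z)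
  ... | no ¬bigger = X , ⊆-refl , pX , λ Z pZ X⊂Z → ¬bigger (Z , pZ , X⊂Z)
  ... | yes (Z , pZ , X⊂Z) with go pZ (larger X⊂Z)
  ...   | Y , Z⊆Y , pY , maxY = Y , ⊆-trans (p⊂q⇒p⊆q X⊂Z) Z⊆Y , pY , maxY

∑ˢ : ∀ {k} → (Subset k → ℕ) → ℕ
∑ˢ {zero}  f = f []
∑ˢ {suc k} f = ∑ˢ (f ∘ (inside ∷_)) + ∑ˢ (f ∘ (outside ∷_))

∑ˢ-cong : ∀ {k} {f g : Subset k → ℕ} → (∀ Y → f Y ≡ g Y) → ∑ˢ f ≡ ∑ˢ g
∑ˢ-cong {zero}  f≡g = f≡g []
∑ˢ-cong {suc k} f≡g = cong₂ _+_ (∑ˢ-cong (f≡g ∘ (inside ∷_))) (∑ˢ-cong (f≡g ∘ (outside ∷_)))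

∑ˢ-mono-≤ : ∀ {k} {f g : Subset k → ℕ} → (∀ Y → f Y ≤ g Y) → ∑ˢ f ≤ ∑ˢ g
∑ˢ-mono-≤ {zero}  f≤g = f≤g []
∑ˢ-mono-≤ {suc k} f≤g = +-mono-≤ (∑ˢ-mono-≤ (f≤g ∘ (inside ∷_))) (∑ˢ-mono-≤ (f≤g ∘ (outside ∷_)))

∑ˢ-distrib-+ : ∀ {k} (f g : Subset k → ℕ) → ∑ˢ (λ Y → f Y + g Y) ≡ ∑ˢ f + ∑ˢ g
∑ˢ-distrib-+ {zero}  f g = refl
∑ˢ-distrib-+ {suc k} f g = trans
  (cong₂ _+_ (∑ˢ-distrib-+ (f ∘ (inside ∷_)) (g ∘ (inside ∷_))) (∑ˢ-distrib-+ (f ∘ (outside ∷_)) (g ∘ (outside ∷_))))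
  (+-interchange (∑ˢ (f ∘ (inside ∷_))) _ _ _)

*-distribˡ-∑ˢ : ∀ {k} c (f : Subset k → ℕ) → c * ∑ˢ f ≡ ∑ˢ (λ Y → c * f Y)
*-distribˡ-∑ˢ {zero}  c f = refl
*-distribˡ-∑ˢ {suc k} c f = trans (*-distribˡ-+ c _ _)
  (cong₂ _+_ (*-distribˡ-∑ˢ c (f ∘ (inside ∷_))) (*-distribˡ-∑ˢ c (f ∘ (outside ∷_))))

∑-∑ˢ-comm : ∀ {k j} (h : Fin k → Subset j → ℕ) → sum (λ i → ∑ˢ (h i)) ≡ ∑ˢ (λ Y → sum (λ i → h i Y))
∑-∑ˢ-comm {j = zero}  h = refl
∑-∑ˢ-comm {j = suc j} h = trans
  (∑-distrib-+ (λ i → ∑ˢ (h i ∘ (inside ∷_))) (λ i → ∑ˢ (h i ∘ (outside ∷_))))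
  (cong₂ _+_ (∑-∑ˢ-comm (λ i → h i ∘ (inside ∷_))) (∑-∑ˢ-comm (λ i → h i ∘ (outside ∷_))))

f≤∑ˢf : ∀ {k} (f : Subset k → ℕ) Y → f Y ≤ ∑ˢ f
f≤∑ˢf f []            = ≤-refl
f≤∑ˢf f (inside  ∷ Y) = ≤-trans (f≤∑ˢf (f ∘ (inside ∷_)) Y) (m≤m+n _ _)
f≤∑ˢf f (outside ∷ Y) = ≤-trans (f≤∑ˢf (f ∘ (outside ∷_)) Y) (m≤n+m _ _)

∑ˢ-[]-false : ∀ {k} (p : Subset k → Bool) → (∀ Y → p Y ≡ false) → ∑ˢ ([_] ∘ p) ≡ 0
∑ˢ-[]-false {k} p p≡false = trans (∑ˢ-cong (λ Y → cong [_] (p≡false Y))) (zeros k)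
  where
  zeros : ∀ k → ∑ˢ {k} (λ _ → 0) ≡ 0
  zeros zero    = refl
  zeros (suc k) = cong₂ _+_ (zeros k) (zeros k)

∑ˢ-[]-unique : ∀ {k} (p : Subset k → Bool) → (∀ {Y Y′} → p Y ≡ true → p Y′ ≡ true → Y ≡ Y′) → ∑ˢ ([_] ∘ p) ≤ 1
∑ˢ-[]-unique {zero}  p unique = [b]≤1 (p [])
∑ˢ-[]-unique {suc k} p unique with anySubset? (λ Y → p (inside ∷ Y) Boolₚ.≟ true)
... | yes (Y , pY) = begin
  ∑ˢ ([_] ∘ p ∘ (inside ∷_)) + ∑ˢ ([_] ∘ p ∘ (outside ∷_))
    ≡⟨ cong (∑ˢ ([_] ∘ p ∘ (inside ∷_)) +_) (∑ˢ-[]-false _ outsideFalse) ⟩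
  ∑ˢ ([_] ∘ p ∘ (inside ∷_)) + 0
    ≡⟨ +-identityʳ _ ⟩
  ∑ˢ ([_] ∘ p ∘ (inside ∷_))
    ≤⟨ ∑ˢ-[]-unique _ (λ pZ pZ′ → cong tail (unique pZ pZ′)) ⟩
  1 ∎
  where
  open ≤-Reasoning
  outsideFalse : ∀ Z → p (outside ∷ Z) ≡ false
  outsideFalse Z with p (outside ∷ Z) in pZ
  ... | true  with () ← unique pY pZ
  ... | false = refl
... | no ¬inside = begin
  ∑ˢ ([_] ∘ p ∘ (inside ∷_)) + ∑ˢ ([_] ∘ p ∘ (outside ∷_))
    ≡⟨ cong (_+ ∑ˢ ([_] ∘ p ∘ (outside ∷_))) (∑ˢ-[]-false _ (λ Z → Boolₚ.¬-not (λ pZ → ¬inside (Z , pZ)))) ⟩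
  ∑ˢ ([_] ∘ p ∘ (outside ∷_))
    ≤⟨ ∑ˢ-[]-unique _ (λ pZ pZ′ → cong tail (unique pZ pZ′)) ⟩
  1 ∎
  where open ≤-Reasoning

∑ˢ-count : ∀ {k j} (p : Subset k → Bool) (q : Subset k → Fin j → Bool)
         → ∑ˢ (λ Y → [ p Y ] * count (q Y)) ≡ sum (λ e → ∑ˢ (λ Y → [ p Y ∧ q Y e ]))
∑ˢ-count p q = begin
  ∑ˢ (λ Y → [ p Y ] * count (q Y))            ≡⟨ ∑ˢ-cong (λ Y → cong ([ p Y ] *_) (count≡sum (q Y))) ⟩
  ∑ˢ (λ Y → [ p Y ] * sum ([_] ∘ q Y))        ≡⟨ ∑ˢ-cong (λ Y → *-distribˡ-sum [ p Y ] ([_] ∘ q Y)) ⟩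
  ∑ˢ (λ Y → sum (λ e → [ p Y ] * [ q Y e ]))  ≡⟨ ∑ˢ-cong (λ Y → sum-cong-≗ (λ e → [x∧y]≡[x]*[y] (p Y) (q Y e))) ⟨
  ∑ˢ (λ Y → sum (λ e → [ p Y ∧ q Y e ]))      ≡⟨ ∑-∑ˢ-comm (λ e Y → [ p Y ∧ q Y e ]) ⟨
  sum (λ e → ∑ˢ (λ Y → [ p Y ∧ q Y e ]))      ∎
  where open ≡-Reasoning

∑ˢ-sumSingle : ∀ {k} (ℓ : Subset k → ℕ) (p : Subset k → Bool) (g : Subset k → Subset k)
             → ∑ˢ (λ Y → [ p Y ] * sumSingle ℓ (g Y)) ≡ sum (λ v → ℓ ⁅ v ⁆ * ∑ˢ (λ Y → [ p Y ∧ lookup (g Y) v ]))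
∑ˢ-sumSingle ℓ p g = begin
  ∑ˢ (λ Y → [ p Y ] * sumSingle ℓ (g Y))
    ≡⟨ ∑ˢ-cong (λ Y → cong ([ p Y ] *_) (sumSingle≡sum ℓ (g Y))) ⟩
  ∑ˢ (λ Y → [ p Y ] * sum (λ v → [ lookup (g Y) v ] * ℓ ⁅ v ⁆))
    ≡⟨ ∑ˢ-cong (λ Y → *-distribˡ-sum [ p Y ] (λ v → [ lookup (g Y) v ] * ℓ ⁅ v ⁆)) ⟩
  ∑ˢ (λ Y → sum (λ v → [ p Y ] * ([ lookup (g Y) v ] * ℓ ⁅ v ⁆)))
    ≡⟨ ∑ˢ-cong (λ Y → sum-cong-≗ (λ v → [p]*[[x]*l]≡l*[p∧x] (p Y) (lookup (g Y) v) (ℓ ⁅ v ⁆))) ⟩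
  ∑ˢ (λ Y → sum (λ v → ℓ ⁅ v ⁆ * [ p Y ∧ lookup (g Y) v ]))
    ≡⟨ ∑-∑ˢ-comm (λ v Y → ℓ ⁅ v ⁆ * [ p Y ∧ lookup (g Y) v ]) ⟨
  sum (λ v → ∑ˢ (λ Y → ℓ ⁅ v ⁆ * [ p Y ∧ lookup (g Y) v ]))
    ≡⟨ sum-cong-≗ (λ v → *-distribˡ-∑ˢ (ℓ ⁅ v ⁆) (λ Y → [ p Y ∧ lookup (g Y) v ])) ⟨
  sum (λ v → ℓ ⁅ v ⁆ * ∑ˢ (λ Y → [ p Y ∧ lookup (g Y) v ])) ∎
  where open ≡-Reasoning

spans : (G : Graph) → VSet G → Fin (m G) → Bool
spans G X e = lookup X (end₁ G e) ∧ lookup X (end₂ G e)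

spans⇒end₁∈ : ∀ G {X} e → spans G X e ≡ true → end₁ G e ∈ X
spans⇒end₁∈ G {X} e spansXe = lookup⇒[]= (end₁ G e) X (Boolₚ.∧-conicalˡ (lookup X (end₁ G e)) _ spansXe)

spans⇒end₂∈ : ∀ G {X} e → spans G X e ≡ true → end₂ G e ∈ X
spans⇒end₂∈ G {X} e spansXe = lookup⇒[]= (end₂ G e) X (Boolₚ.∧-conicalʳ (lookup X (end₁ G e)) _ spansXe)

spans-mono : ∀ G {X Y} e → X ⊆ Y → spans G X e ≡ true → spans G Y e ≡ true
spans-mono G e X⊆Y spansXe =
  cong₂ _∧_ ([]=⇒lookup (X⊆Y (spans⇒end₁∈ G e spansXe))) ([]=⇒lookup (X⊆Y (spans⇒end₂∈ G e spansXe)))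

spans-∩ : ∀ G X Y e → spans G (X ∩ Y) e ≡ spans G X e ∧ spans G Y e
spans-∩ G X Y e
  rewrite lookup-zipWith _∧_ (end₁ G e) X Y | lookup-zipWith _∧_ (end₂ G e) X Y
  = ∧-interchange (lookup X (end₁ G e)) _ _ _

spans-∪ : ∀ G X Y e → spans G X e ∨ spans G Y e ≡ true → spans G (X ∪ Y) e ≡ true
spans-∪ G X Y e
  rewrite lookup-zipWith _∨_ (end₁ G e) X Y | lookup-zipWith _∨_ (end₂ G e) X Y
  = ∨-∧⇒∧-∨ (lookup X (end₁ G e)) (lookup X (end₂ G e)) _ _
  where
  ∨-∧⇒∧-∨ : ∀ x₁ x₂ y₁ y₂ → (x₁ ∧ x₂) ∨ (y₁ ∧ y₂) ≡ true → (x₁ ∨ y₁) ∧ (x₂ ∨ y₂) ≡ true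
  ∨-∧⇒∧-∨ true  true  y₁    y₂    _ = refl
  ∨-∧⇒∧-∨ x₁    x₂    true  true  _ = cong₂ _∧_ (Boolₚ.∨-zeroʳ x₁) (Boolₚ.∨-zeroʳ x₂)
  ∨-∧⇒∧-∨ true  false true  false ()
  ∨-∧⇒∧-∨ true  false false y₂    ()
  ∨-∧⇒∧-∨ false x₂    true  false ()
  ∨-∧⇒∧-∨ false x₂    false y₂    ()

eIn≡sum : ∀ G F X → eIn G F X ≡ sum (λ e → [ lookup F e ∧ spans G X e ])
eIn≡sum G F X = count≡sum (λ e → lookup F e ∧ spans G X e)

eIn-supermodular : ∀ G F X Y → eIn G F X + eIn G F Y ≤ eIn G F (X ∩ Y) + eIn G F (X ∪ Y)
eIn-supermodular G F X Y = begin
  eIn G F X + eIn G F Y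
    ≡⟨ cong₂ _+_ (eIn≡sum G F X) (eIn≡sum G F Y) ⟩
  sum (λ e → [ lookup F e ∧ spans G X e ]) + sum (λ e → [ lookup F e ∧ spans G Y e ])
    ≡⟨ ∑-distrib-+ (λ e → [ lookup F e ∧ spans G X e ]) _ ⟨
  sum (λ e → [ lookup F e ∧ spans G X e ] + [ lookup F e ∧ spans G Y e ])
    ≤⟨ sum-mono-≤ (λ e → perEdge (lookup F e) e) ⟩
  sum (λ e → [ lookup F e ∧ spans G (X ∩ Y) e ] + [ lookup F e ∧ spans G (X ∪ Y) e ])
    ≡⟨ ∑-distrib-+ (λ e → [ lookup F e ∧ spans G (X ∩ Y) e ]) _ ⟩
  sum (λ e → [ lookup F e ∧ spans G (X ∩ Y) e ]) + sum (λ e → [ lookup F e ∧ spans G (X ∪ Y) e ])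
    ≡⟨ cong₂ _+_ (eIn≡sum G F (X ∩ Y)) (eIn≡sum G F (X ∪ Y)) ⟨
  eIn G F (X ∩ Y) + eIn G F (X ∪ Y) ∎
  where
  open ≤-Reasoning
  perEdge : ∀ f e → [ f ∧ spans G X e ] + [ f ∧ spans G Y e ] ≤ [ f ∧ spans G (X ∩ Y) e ] + [ f ∧ spans G (X ∪ Y) e ]
  perEdge false e = z≤n
  perEdge true  e rewrite [x]+[y]≡[x∧y]+[x∨y] (spans G X e) (spans G Y e) | spans-∩ G X Y e =
    +-monoʳ-≤ [ spans G X e ∧ spans G Y e ] ([x]≤[y] (spans-∪ G X Y e))

eIn-⊥ : ∀ G X → eIn G ⊥ X ≡ 0
eIn-⊥ G X = begin
  eIn G ⊥ X                                   ≡⟨ eIn≡sum G ⊥ X ⟩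
  sum (λ e → [ lookup ⊥ e ∧ spans G X e ])
    ≡⟨ sum-cong-≗ (λ e → cong (λ b → [ b ∧ spans G X e ]) (lookup-replicate e false)) ⟩
  sum {m G} (λ _ → 0)                         ≡⟨ sum-replicate-zero (m G) ⟩
  0                                           ∎
  where open ≡-Reasoning

eIn-⊤ : ∀ G F → eIn G F ⊤ ≡ ∣ F ∣
eIn-⊤ G F = begin
  eIn G F ⊤                                   ≡⟨ eIn≡sum G F ⊤ ⟩
  sum (λ e → [ lookup F e ∧ spans G ⊤ e ])    ≡⟨ sum-cong-≗ (λ e → cong (λ b → [ lookup F e ∧ b ]) (spans-⊤ e)) ⟩
  sum (λ e → [ lookup F e ∧ true ])           ≡⟨ sum-cong-≗ (λ e → cong [_] (Boolₚ.∧-identityʳ (lookup F e))) ⟩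
  sum ([_] ∘ lookup F)                        ≡⟨ ∣p∣≡sum F ⟨
  ∣ F ∣                                       ∎
  where
  open ≡-Reasoning
  spans-⊤ : ∀ e → spans G ⊤ e ≡ true
  spans-⊤ e = cong₂ _∧_ (lookup-replicate (end₁ G e) true) (lookup-replicate (end₂ G e) true)

eIn<eIn-⊤ : ∀ G F X e → e ∉ F → spans G X e ≡ true → eIn G F X < eIn G ⊤ X
eIn<eIn-⊤ G F X e e∉F spansXe = begin-strict
  eIn G F X                                   ≡⟨ eIn≡sum G F X ⟩
  sum (λ f → [ lookup F f ∧ spans G X f ])    <⟨ sum-mono-< perEdge e atE ⟩
  sum (λ f → [ lookup ⊤ f ∧ spans G X f ])    ≡⟨ eIn≡sum G ⊤ X ⟨
  eIn G ⊤ X                                   ∎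
  where
  open ≤-Reasoning
  perEdge : ∀ f → [ lookup F f ∧ spans G X f ] ≤ [ lookup ⊤ f ∧ spans G X f ]
  perEdge f rewrite lookup-replicate f true = [x]≤[y] (Boolₚ.∧-conicalʳ (lookup F f) _)
  atE : [ lookup F e ∧ spans G X e ] < [ lookup ⊤ e ∧ spans G X e ]
  atE rewrite lookup-replicate e true | spansXe | Boolₚ.¬-not (e∉F ∘ lookup⇒[]= e F) = s≤s z≤n

∑-weighted-degree : ∀ G (w : Fin (n G) → ℕ)
                  → sum (λ v → w v * dIn G ⊤ ⁅ v ⁆) ≡ sum (λ e → w (end₁ G e) + w (end₂ G e))
∑-weighted-degree G w = begin
  sum (λ v → w v * dIn G ⊤ ⁅ v ⁆)
    ≡⟨ sum-cong-≗ (λ v → trans (cong (w v *_) (count≡sum (incident v))) (*-distribˡ-sum (w v) ([_] ∘ incident v))) ⟩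
  sum (λ v → sum (λ e → w v * [ incident v e ]))
    ≡⟨ ∑-comm (λ v e → w v * [ incident v e ]) ⟩
  sum (λ e → sum (λ v → w v * [ incident v e ]))
    ≡⟨ sum-cong-≗ (λ e → sum-cong-≗ (perIncidence e)) ⟩
  sum (λ e → sum (λ v → [ lookup ⁅ a e ⁆ v ] * w v + [ lookup ⁅ b e ⁆ v ] * w v))
    ≡⟨ sum-cong-≗ (λ e → trans (∑-distrib-+ (λ v → [ lookup ⁅ a e ⁆ v ] * w v) _)
                               (cong₂ _+_ (sum-⁅⁆ (a e) w) (sum-⁅⁆ (b e) w))) ⟩
  sum (λ e → w (a e) + w (b e)) ∎
  where
  open ≡-Reasoning
  a b : Fin (m G) → Fin (n G)
  a = end₁ G
  b = end₂ G
  incident : Fin (n G) → Fin (m G) → Bool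
  incident v e = lookup ⊤ e ∧ (lookup ⁅ v ⁆ (a e) xor lookup ⁅ v ⁆ (b e))
  xor-split : ∀ w x y → ¬ (x ≡ true × y ≡ true) → w * [ true ∧ (x xor y) ] ≡ [ x ] * w + [ y ] * w
  xor-split w true  true  not-both = ⊥-elim (not-both (refl , refl))
  xor-split w true  false not-both = trans (*-identityʳ w) (sym (trans (+-identityʳ (w + 0)) (+-identityʳ w)))
  xor-split w false true  not-both = trans (*-identityʳ w) (sym (+-identityʳ w))
  xor-split w false false not-both = *-zeroʳ w
  perIncidence : ∀ e v → w v * [ incident v e ] ≡ [ lookup ⁅ a e ⁆ v ] * w v + [ lookup ⁅ b e ⁆ v ] * w v
  perIncidence e v
    rewrite lookup-replicate e true | lookup-⁅⁆-sym (a e) v | lookup-⁅⁆-sym (b e) v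
    = xor-split (w v) (lookup ⁅ v ⁆ (a e)) (lookup ⁅ v ⁆ (b e)) λ (va , vb) →
        loopless G e (trans (x∈⁅y⁆⇒x≡y v (lookup⇒[]= (a e) ⁅ v ⁆ va)) (sym (x∈⁅y⁆⇒x≡y v (lookup⇒[]= (b e) ⁅ v ⁆ vb))))

-- Sparse and tight edge sets

module Sparsity (G : Graph) (ℓ : VSet G → ℕ) where

  σ : VSet G → ℕ
  σ = sumSingle ℓ

  Sparse : ESet G → Set
  Sparse F = ∀ X → eIn G F X + ℓ X ≤ σ X

  Tight : ESet G → VSet G → Set
  Tight F X = eIn G F X + ℓ X ≡ σ X

  MaximalTight : ESet G → VSet G → Set
  MaximalTight F X = Tight F X × (∀ Z → Tight F Z → ¬ X ⊂ Z)

  violation? : ∀ F → Dec (∃ λ X → σ X < eIn G F X + ℓ X)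
  violation? F = anySubset? (λ X → σ X <? eIn G F X + ℓ X)

  sparse? : ∀ F → Dec (Sparse F)
  sparse? F with violation? F
  ... | yes (X , σX<) = no (λ sparse → <⇒≱ σX< (sparse X))
  ... | no ¬violation = yes (λ X → ≮⇒≥ (λ σX< → ¬violation (X , σX<)))

  ¬sparse⇒violation : ∀ F → ¬ Sparse F → ∃ λ X → σ X < eIn G F X + ℓ X
  ¬sparse⇒violation F ¬sparse with violation? F
  ... | yes violation = violation
  ... | no ¬violation = ⊥-elim (¬sparse (λ X → ≮⇒≥ (λ σX< → ¬violation (X , σX<))))

  tight? : ∀ F X → Dec (Tight F X)
  tight? F X = eIn G F X + ℓ X ≟ σ X

  maximalTight? : ∀ F X → Dec (MaximalTight F X)
  maximalTight? F X with tight? F X | anySubset? (λ Z → tight? F Z ×-dec X ⊂? Z)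
  ... | no ¬tight | _                  = no (¬tight ∘ proj₁)
  ... | yes tight | yes (Z , tZ , X⊂Z) = no (λ (_ , maximal) → maximal Z tZ X⊂Z)
  ... | yes tight | no ¬bigger         = yes (tight , λ Z tZ X⊂Z → ¬bigger (Z , tZ , X⊂Z))

  tight⇒maximalTight : ∀ F {X} → Tight F X → ∃ λ Y → X ⊆ Y × MaximalTight F Y
  tight⇒maximalTight F = ⊆-maximal (tight? F)

  sparse-⊥ : WeaklySubadditive ℓ → Sparse ⊥
  sparse-⊥ subadditive X rewrite eIn-⊥ G X = subadditive X

  module _ (supermodular : TwoIntersectingSupermodular ℓ) (F : ESet G) (sparse : Sparse F) where

    tight-∪ : ∀ {X Y} → Tight F X → Tight F Y → 2 ≤ ∣ X ∩ Y ∣ → Tight F (X ∪ Y)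
    tight-∪ {X} {Y} tX tY 2≤∣X∩Y∣ = ≤-antisym (sparse (X ∪ Y)) (+-cancelˡ-≤ (σ (X ∩ Y)) _ _ (begin
      σ (X ∩ Y) + σ (X ∪ Y)                        ≡⟨ sumSingle-modular ℓ X Y ⟨
      σ X + σ Y                                    ≡⟨ cong₂ _+_ tX tY ⟨
      (eIn G F X + ℓ X) + (eIn G F Y + ℓ Y)        ≡⟨ +-interchange (eIn G F X) _ _ _ ⟩
      (eIn G F X + eIn G F Y) + (ℓ X + ℓ Y)        ≤⟨ +-mono-≤ (eIn-supermodular G F X Y) (supermodular X Y 2≤∣X∩Y∣) ⟩
      (eIn G F (X ∩ Y) + eIn G F (X ∪ Y)) + (ℓ (X ∩ Y) + ℓ (X ∪ Y))
                                                   ≡⟨ +-interchange (eIn G F (X ∩ Y)) _ _ _ ⟩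
      (eIn G F (X ∩ Y) + ℓ (X ∩ Y)) + (eIn G F (X ∪ Y) + ℓ (X ∪ Y))
                                                   ≤⟨ +-monoˡ-≤ _ (sparse (X ∩ Y)) ⟩
      σ (X ∩ Y) + (eIn G F (X ∪ Y) + ℓ (X ∪ Y))    ∎))
      where open ≤-Reasoning

    ⊆-maximalTight : ∀ {X Y} → MaximalTight F X → Tight F (X ∪ Y) → Y ⊆ X
    ⊆-maximalTight {X} {Y} (_ , maximal) tX∪Y {w} w∈Y with w ∈? X
    ... | yes w∈X = w∈X
    ... | no  w∉X = ⊥-elim (maximal (X ∪ Y) tX∪Y (p⊆p∪q Y , w , q⊆p∪q X Y w∈Y , w∉X))

    maximalTight-unique : ∀ {X Y u v} → u ≢ v → MaximalTight F X → MaximalTight F Y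
                        → u ∈ X → v ∈ X → u ∈ Y → v ∈ Y → X ≡ Y
    maximalTight-unique {X} {Y} u≢v mX mY u∈X v∈X u∈Y v∈Y = ⊆-antisym
      (⊆-maximalTight mY (subst (Tight F) (∪-comm X Y) tX∪Y))
      (⊆-maximalTight mX tX∪Y)
      where
      tX∪Y = tight-∪ (proj₁ mX) (proj₁ mY) (two≤∣p∣ u≢v (x∈p∩q⁺ (u∈X , u∈Y)) (x∈p∩q⁺ (v∈X , v∈Y)))

  eIn-∪⁅⁆ : ∀ F e X → eIn G (F ∪ ⁅ e ⁆) X ≤ eIn G F X + [ spans G X e ]
  eIn-∪⁅⁆ F e X = begin
    eIn G (F ∪ ⁅ e ⁆) X
      ≡⟨ eIn≡sum G (F ∪ ⁅ e ⁆) X ⟩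
    sum (λ f → [ lookup (F ∪ ⁅ e ⁆) f ∧ spans G X f ])
      ≤⟨ sum-mono-≤ perEdge ⟩
    sum (λ f → [ lookup F f ∧ spans G X f ] + [ lookup ⁅ e ⁆ f ] * [ spans G X f ])
      ≡⟨ ∑-distrib-+ (λ f → [ lookup F f ∧ spans G X f ]) _ ⟩
    sum (λ f → [ lookup F f ∧ spans G X f ]) + sum (λ f → [ lookup ⁅ e ⁆ f ] * [ spans G X f ])
      ≡⟨ cong₂ _+_ (eIn≡sum G F X) (sym (sum-⁅⁆ e (λ f → [ spans G X f ]))) ⟨
    eIn G F X + [ spans G X e ] ∎
    where
    open ≤-Reasoning
    ∨-∧-bound : ∀ x y z → [ (x ∨ y) ∧ z ] ≤ [ x ∧ z ] + [ y ] * [ z ]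
    ∨-∧-bound true  y     true  = s≤s z≤n
    ∨-∧-bound false true  true  = ≤-refl
    ∨-∧-bound false false true  = z≤n
    ∨-∧-bound x     y     false rewrite Boolₚ.∧-zeroʳ (x ∨ y) = z≤n
    perEdge : ∀ f → [ lookup (F ∪ ⁅ e ⁆) f ∧ spans G X f ] ≤ [ lookup F f ∧ spans G X f ] + [ lookup ⁅ e ⁆ f ] * [ spans G X f ]
    perEdge f rewrite lookup-zipWith _∨_ f F ⁅ e ⁆ = ∨-∧-bound (lookup F f) (lookup ⁅ e ⁆ f) (spans G X f)

  blocked⇒spanned : ∀ F {e} → Sparse F → ¬ Sparse (F ∪ ⁅ e ⁆) → ∃ λ X → Tight F X × spans G X e ≡ true
  blocked⇒spanned F {e} sparse ¬sparse′ with ¬sparse⇒violation (F ∪ ⁅ e ⁆) ¬sparse′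
  ... | X , σX< with spans G X e in spansXe
  ... | true  = X , ≤-antisym (sparse X) (≤-pred (begin-strict
    σ X                                   <⟨ σX< ⟩
    eIn G (F ∪ ⁅ e ⁆) X + ℓ X             ≤⟨ +-monoˡ-≤ (ℓ X) (eIn-∪⁅⁆ F e X) ⟩
    eIn G F X + [ spans G X e ] + ℓ X     ≡⟨ cong (λ b → eIn G F X + [ b ] + ℓ X) spansXe ⟩
    eIn G F X + 1 + ℓ X                   ≡⟨ cong (_+ ℓ X) (+-comm (eIn G F X) 1) ⟩
    suc (eIn G F X + ℓ X)                 ∎)) , spansXe
    where open ≤-Reasoning
  ... | false = ⊥-elim (<⇒≱ σX< (begin
    eIn G (F ∪ ⁅ e ⁆) X + ℓ X             ≤⟨ +-monoˡ-≤ (ℓ X) (eIn-∪⁅⁆ F e X) ⟩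
    eIn G F X + [ spans G X e ] + ℓ X     ≡⟨ cong (λ b → eIn G F X + [ b ] + ℓ X) spansXe ⟩
    eIn G F X + 0 + ℓ X                   ≡⟨ cong (_+ ℓ X) (+-identityʳ (eIn G F X)) ⟩
    eIn G F X + ℓ X                       ≤⟨ sparse X ⟩
    σ X                                   ∎))
    where open ≤-Reasoning

-- Counting against the members of a family of vertex sets

multiplicity : ∀ {k} → (Subset k → Bool) → Fin k → ℕ
multiplicity 𝒴 v = ∑ˢ (λ Y → [ 𝒴 Y ∧ lookup Y v ])

shared : ∀ {k} → (Subset k → Bool) → Subset k
shared 𝒴 = tabulate (λ v → 1 <ᵇ multiplicity 𝒴 v)

-- Of the k members containing an end of an edge, x miss the other end and c contain both.
endpoint-bound : ∀ x c k → x + c ≡ k → [ not (1 <ᵇ k) ] * x + [ k ≡ᵇ 0 ] ≤ [ c ≡ᵇ 0 ]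
endpoint-bound 0             0       _ refl = ≤-refl
endpoint-bound 1             0       _ refl = ≤-refl
endpoint-bound (suc (suc x)) 0       _ refl = z≤n
endpoint-bound 0             (suc c) _ refl = ≤-reflexive (trans (+-identityʳ _) (*-zeroʳ [ not (1 <ᵇ suc c) ]))
endpoint-bound (suc x)       (suc c) _ refl rewrite +-suc x c = z≤n

leaving-bound : ∀ p yᵤ yᵥ sᵤ sᵥ
              → [ p ∧ (not ((yᵤ ∧ sᵤ) ∨ (yᵥ ∧ sᵥ)) ∧ ((yᵤ ∧ not sᵤ) xor (yᵥ ∧ not sᵥ))) ]
                ≤ [ not sᵤ ] * [ p ∧ (yᵤ ∧ not yᵥ) ] + [ not sᵥ ] * [ p ∧ (yᵥ ∧ not yᵤ) ]
leaving-bound false _     _     _     _     = z≤n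
leaving-bound true  false false _     _     = z≤n
leaving-bound true  true  false true  _     = z≤n
leaving-bound true  true  false false _     = s≤s z≤n
leaving-bound true  false true  _     true  = z≤n
leaving-bound true  false true  sᵤ    false = m≤n+m 1 _
leaving-bound true  true  true  true  _     = z≤n
leaving-bound true  true  true  false true  = z≤n
leaving-bound true  true  true  false false = z≤n

vertex-bound : ∀ l k → 2 * l + l * ([ 1 <ᵇ k ] * k) ≤ 2 * (l * k) + 2 * ([ k ≡ᵇ 0 ] * l)
vertex-bound l 0             = ≤-reflexive (k≡0 l)
  where
  k≡0 : ∀ l → 2 * l + l * (0 * 0) ≡ 2 * (l * 0) + 2 * (1 * l)
  k≡0 = solve-∀
vertex-bound l 1             = ≤-reflexive (k≡1 l)
  where
  k≡1 : ∀ l → 2 * l + l * (0 * 1) ≡ 2 * (l * 1) + 2 * (0 * l)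
  k≡1 = solve-∀
vertex-bound l (suc (suc k)) = ≤-trans (m≤m+n _ (l * k)) (≤-reflexive (k≥2 l k))
  where
  k≥2 : ∀ l k → 2 * l + l * (1 * (2 + k)) + l * k ≡ 2 * (l * (2 + k)) + 2 * (0 * l)
  k≥2 = solve-∀

module Counting
  (G : Graph) (ℓ : VSet G → ℕ) (F M : ESet G) (𝒴 : VSet G → Bool)
  (tight : ∀ {Y} → 𝒴 Y ≡ true → eIn G F Y + ℓ Y ≡ sumSingle ℓ Y)
  (unique : ∀ e {Y Y′} → 𝒴 Y ≡ true → 𝒴 Y′ ≡ true → spans G Y e ≡ true → spans G Y′ e ≡ true → Y ≡ Y′)
  (covered : ∀ e → lookup M e ≡ false → lookup F e ≡ false → ∃ λ Y → 𝒴 Y ≡ true × spans G Y e ≡ true)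
  (degree : ∀ v → 2 * ℓ ⁅ v ⁆ ≤ dIn G ⊤ ⁅ v ⁆)
  (separation : ∀ {Y} → 𝒴 Y ≡ true
              → 2 * ℓ Y ≤ dMinus G (Y ∩ shared 𝒴) (Y ∩ ∁ (shared 𝒴)) + sumSingle ℓ (Y ∩ shared 𝒴))
  where

  private
    L : Fin (n G) → ℕ
    L v = ℓ ⁅ v ⁆
    k : Fin (n G) → ℕ
    k = multiplicity 𝒴
    a b : Fin (m G) → Fin (n G)
    a = end₁ G
    b = end₂ G
    sh : VSet G
    sh = shared 𝒴
    leaving : VSet G → Fin (m G) → Bool
    leaving Y e = not (lookup (Y ∩ sh) (a e) ∨ lookup (Y ∩ sh) (b e))
                ∧ (lookup (Y ∩ ∁ sh) (a e) xor lookup (Y ∩ ∁ sh) (b e))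
    exits : VSet G → Fin (n G) → Fin (n G) → Bool
    exits Y u w = lookup Y u ∧ not (lookup Y w)
    exiting : Fin (n G) → Fin (n G) → ℕ
    exiting u w = ∑ˢ (λ Y → [ 𝒴 Y ∧ exits Y u w ])

  coverage : Fin (m G) → ℕ
  coverage e = ∑ˢ (λ Y → [ 𝒴 Y ∧ spans G Y e ])

  coverage≤1 : ∀ e → coverage e ≤ 1
  coverage≤1 e = ∑ˢ-[]-unique (λ Y → 𝒴 Y ∧ spans G Y e) λ {Y} {Y′} p p′ →
    unique e (Boolₚ.∧-conicalˡ (𝒴 Y) _ p) (Boolₚ.∧-conicalˡ (𝒴 Y′) _ p′)
             (Boolₚ.∧-conicalʳ (𝒴 Y) _ p) (Boolₚ.∧-conicalʳ (𝒴 Y′) _ p′)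

  uncovered-bound : ∀ e → [ coverage e ≡ᵇ 0 ] ≤ [ lookup M e ] + [ lookup F e ] * [ coverage e ≡ᵇ 0 ]
  uncovered-bound e with lookup M e in Me | lookup F e in Fe
  ... | true  | _     = ≤-trans ([b]≤1 _) (m≤m+n 1 _)
  ... | false | true  = ≤-reflexive (sym (+-identityʳ _))
  ... | false | false with covered e Me Fe
  ...   | Y , 𝒴Y , spansY = ≤-trans (≤-reflexive (positive (coverage e) 1≤coverage)) z≤n
    where
    1≤coverage : 1 ≤ coverage e
    1≤coverage = ≤-trans (≤-reflexive (cong [_] (sym (cong₂ _∧_ 𝒴Y spansY))))
                         (f≤∑ˢf (λ Y → [ 𝒴 Y ∧ spans G Y e ]) Y)
    positive : ∀ c → 1 ≤ c → [ c ≡ᵇ 0 ] ≡ 0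
    positive (suc c) _ = refl

  C K S U Z D₁ D₂ T : ℕ
  C  = sum (λ e → [ lookup F e ] * coverage e)
  K  = ∑ˢ (λ Y → [ 𝒴 Y ] * ℓ Y)
  S  = sum (λ v → L v * k v)
  U  = sum (λ e → [ lookup F e ] * [ coverage e ≡ᵇ 0 ])
  Z  = sum (λ v → [ k v ≡ᵇ 0 ] * L v)
  D₁ = ∑ˢ (λ Y → [ 𝒴 Y ] * dMinus G (Y ∩ sh) (Y ∩ ∁ sh))
  D₂ = sum (λ v → [ k v ≡ᵇ 0 ] * dIn G ⊤ ⁅ v ⁆)
  T  = sum (λ v → L v * ([ 1 <ᵇ k v ] * k v))

  tight-count : C + K ≡ S
  tight-count = begin
    C + K                                                    ≡⟨ cong (_+ K) ∑ˢ-eIn ⟨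
    ∑ˢ (λ Y → [ 𝒴 Y ] * eIn G F Y) + K                       ≡⟨ ∑ˢ-distrib-+ (λ Y → [ 𝒴 Y ] * eIn G F Y) _ ⟨
    ∑ˢ (λ Y → [ 𝒴 Y ] * eIn G F Y + [ 𝒴 Y ] * ℓ Y)          ≡⟨ ∑ˢ-cong member-tight ⟩
    ∑ˢ (λ Y → [ 𝒴 Y ] * sumSingle ℓ Y)                       ≡⟨ ∑ˢ-sumSingle ℓ 𝒴 (λ Y → Y) ⟩
    S                                                        ∎
    where
    open ≡-Reasoning
    ∑ˢ-eIn : ∑ˢ (λ Y → [ 𝒴 Y ] * eIn G F Y) ≡ C
    ∑ˢ-eIn = trans (∑ˢ-count 𝒴 (λ Y e → lookup F e ∧ spans G Y e)) (sum-cong-≗ λ e →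
      trans (∑ˢ-cong (λ Y → [x∧[y∧z]]≡[y]*[x∧z] (𝒴 Y) (lookup F e) (spans G Y e)))
            (sym (*-distribˡ-∑ˢ [ lookup F e ] (λ Y → [ 𝒴 Y ∧ spans G Y e ]))))
    member-tight : ∀ Y → [ 𝒴 Y ] * eIn G F Y + [ 𝒴 Y ] * ℓ Y ≡ [ 𝒴 Y ] * sumSingle ℓ Y
    member-tight Y with 𝒴 Y in 𝒴Y
    ... | true  = trans (sym (*-distribˡ-+ 1 (eIn G F Y) (ℓ Y))) (cong (1 *_) (tight 𝒴Y))
    ... | false = refl

  spanned-count : C + U ≤ ∣ F ∣
  spanned-count = begin
    C + U                                                                 ≡⟨ ∑-distrib-+ (λ e → [ lookup F e ] * coverage e) _ ⟨
    sum (λ e → [ lookup F e ] * coverage e + [ lookup F e ] * [ coverage e ≡ᵇ 0 ]) ≤⟨ sum-mono-≤ perEdge ⟩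
    sum ([_] ∘ lookup F)                                                  ≡⟨ ∣p∣≡sum F ⟨
    ∣ F ∣                                                                 ∎
    where
    open ≤-Reasoning
    perEdge : ∀ e → [ lookup F e ] * coverage e + [ lookup F e ] * [ coverage e ≡ᵇ 0 ] ≤ [ lookup F e ]
    perEdge e with lookup F e | coverage e | coverage≤1 e
    ... | false | _           | _       = z≤n
    ... | true  | 0           | _       = ≤-refl
    ... | true  | 1           | _       = ≤-refl
    ... | true  | suc (suc _) | s≤s ()

  separation-count : 2 * K ≤ D₁ + T
  separation-count = begin
    2 * K
      ≡⟨ *-distribˡ-∑ˢ 2 (λ Y → [ 𝒴 Y ] * ℓ Y) ⟩
    ∑ˢ (λ Y → 2 * ([ 𝒴 Y ] * ℓ Y))
      ≤⟨ ∑ˢ-mono-≤ member-separation ⟩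
    ∑ˢ (λ Y → [ 𝒴 Y ] * dMinus G (Y ∩ sh) (Y ∩ ∁ sh) + [ 𝒴 Y ] * sumSingle ℓ (Y ∩ sh))
      ≡⟨ ∑ˢ-distrib-+ (λ Y → [ 𝒴 Y ] * dMinus G (Y ∩ sh) (Y ∩ ∁ sh)) _ ⟩
    D₁ + ∑ˢ (λ Y → [ 𝒴 Y ] * sumSingle ℓ (Y ∩ sh))
      ≡⟨ cong (D₁ +_) (∑ˢ-sumSingle ℓ 𝒴 (_∩ sh)) ⟩
    D₁ + sum (λ v → L v * ∑ˢ (λ Y → [ 𝒴 Y ∧ lookup (Y ∩ sh) v ]))
      ≡⟨ cong (D₁ +_) (sum-cong-≗ (λ v → cong (L v *_) (shared-multiplicity v))) ⟩
    D₁ + T ∎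
    where
    open ≤-Reasoning
    member-separation : ∀ Y → 2 * ([ 𝒴 Y ] * ℓ Y) ≤ [ 𝒴 Y ] * dMinus G (Y ∩ sh) (Y ∩ ∁ sh) + [ 𝒴 Y ] * sumSingle ℓ (Y ∩ sh)
    member-separation Y with 𝒴 Y in 𝒴Y
    ... | true  = subst₂ _≤_ (cong (2 *_) (sym (*-identityˡ (ℓ Y))))
                    (cong₂ _+_ (sym (*-identityˡ (dMinus G (Y ∩ sh) (Y ∩ ∁ sh)))) (sym (*-identityˡ (sumSingle ℓ (Y ∩ sh)))))
                    (separation 𝒴Y)
    ... | false = z≤n
    shared-multiplicity : ∀ v → ∑ˢ (λ Y → [ 𝒴 Y ∧ lookup (Y ∩ sh) v ]) ≡ [ 1 <ᵇ k v ] * k v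
    shared-multiplicity v = begin-equality
      ∑ˢ (λ Y → [ 𝒴 Y ∧ lookup (Y ∩ sh) v ])
        ≡⟨ ∑ˢ-cong (λ Y → cong (λ x → [ 𝒴 Y ∧ x ]) (trans (lookup-zipWith _∧_ v Y sh)
                                                           (cong (lookup Y v ∧_) (lookup∘tabulate _ v)))) ⟩
      ∑ˢ (λ Y → [ 𝒴 Y ∧ (lookup Y v ∧ (1 <ᵇ k v)) ])
        ≡⟨ ∑ˢ-cong (λ Y → [x∧[y∧z]]≡[z]*[x∧y] (𝒴 Y) (lookup Y v) (1 <ᵇ k v)) ⟩
      ∑ˢ (λ Y → [ 1 <ᵇ k v ] * [ 𝒴 Y ∧ lookup Y v ])
        ≡⟨ *-distribˡ-∑ˢ [ 1 <ᵇ k v ] (λ Y → [ 𝒴 Y ∧ lookup Y v ]) ⟨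
      [ 1 <ᵇ k v ] * k v ∎

  degree-count : 2 * Z ≤ D₂
  degree-count = begin
    2 * Z                                    ≡⟨ *-distribˡ-sum 2 (λ v → [ k v ≡ᵇ 0 ] * L v) ⟩
    sum (λ v → 2 * ([ k v ≡ᵇ 0 ] * L v))     ≡⟨ sum-cong-≗ (λ v → x*[y*z]≡y*[x*z] 2 [ k v ≡ᵇ 0 ] (L v)) ⟩
    sum (λ v → [ k v ≡ᵇ 0 ] * (2 * L v))     ≤⟨ sum-mono-≤ (λ v → *-monoʳ-≤ [ k v ≡ᵇ 0 ] (degree v)) ⟩
    D₂                                       ∎
    where open ≤-Reasoning

  member-leaving-bound : ∀ e Y → [ 𝒴 Y ∧ leaving Y e ]
                       ≤ [ not (1 <ᵇ k (a e)) ] * [ 𝒴 Y ∧ exits Y (a e) (b e) ]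
                         + [ not (1 <ᵇ k (b e)) ] * [ 𝒴 Y ∧ exits Y (b e) (a e) ]
  member-leaving-bound e Y
    rewrite lookup-zipWith _∧_ (a e) Y sh | lookup-zipWith _∧_ (b e) Y sh
          | lookup-zipWith _∧_ (a e) Y (∁ sh) | lookup-zipWith _∧_ (b e) Y (∁ sh)
          | lookup-map (a e) not sh | lookup-map (b e) not sh
          | lookup∘tabulate (λ v → 1 <ᵇ k v) (a e) | lookup∘tabulate (λ v → 1 <ᵇ k v) (b e)
    = leaving-bound (𝒴 Y) (lookup Y (a e)) (lookup Y (b e)) (1 <ᵇ k (a e)) (1 <ᵇ k (b e))

  exiting+coverage≡k : ∀ e → exiting (a e) (b e) + coverage e ≡ k (a e) × exiting (b e) (a e) + coverage e ≡ k (b e)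
  exiting+coverage≡k e =
    trans (sym (∑ˢ-distrib-+ (λ Y → [ 𝒴 Y ∧ exits Y (a e) (b e) ]) _))
          (∑ˢ-cong (λ Y → [x∧[y∧¬z]]+[x∧[y∧z]]≡[x∧y] (𝒴 Y) (lookup Y (a e)) (lookup Y (b e)))) ,
    trans (sym (∑ˢ-distrib-+ (λ Y → [ 𝒴 Y ∧ exits Y (b e) (a e) ]) _))
          (∑ˢ-cong (λ Y → trans (cong (λ x → [ 𝒴 Y ∧ exits Y (b e) (a e) ] + [ 𝒴 Y ∧ x ]) (Boolₚ.∧-comm (lookup Y (a e)) _))
                                ([x∧[y∧¬z]]+[x∧[y∧z]]≡[x∧y] (𝒴 Y) (lookup Y (b e)) (lookup Y (a e)))))

  -- D₁ + D₂ counts an edge at most once per end, and not at all if a member spans it.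
  boundary-edge : ∀ e → ∑ˢ (λ Y → [ 𝒴 Y ∧ leaving Y e ]) + ([ k (a e) ≡ᵇ 0 ] + [ k (b e) ≡ᵇ 0 ])
                      ≤ 2 * [ coverage e ≡ᵇ 0 ]
  boundary-edge e = begin
    ∑ˢ (λ Y → [ 𝒴 Y ∧ leaving Y e ]) + (zᵤ + zᵥ)
      ≤⟨ +-monoˡ-≤ (zᵤ + zᵥ) (∑ˢ-mono-≤ (member-leaving-bound e)) ⟩
    ∑ˢ (λ Y → [ nᵤ ] * [ 𝒴 Y ∧ exits Y (a e) (b e) ] + [ nᵥ ] * [ 𝒴 Y ∧ exits Y (b e) (a e) ]) + (zᵤ + zᵥ)
      ≡⟨ cong (_+ (zᵤ + zᵥ)) (trans (∑ˢ-distrib-+ (λ Y → [ nᵤ ] * [ 𝒴 Y ∧ exits Y (a e) (b e) ]) _)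
                                    (cong₂ _+_ (sym (*-distribˡ-∑ˢ [ nᵤ ] (λ Y → [ 𝒴 Y ∧ exits Y (a e) (b e) ])))
                                                (sym (*-distribˡ-∑ˢ [ nᵥ ] (λ Y → [ 𝒴 Y ∧ exits Y (b e) (a e) ]))))) ⟩
    ([ nᵤ ] * exiting (a e) (b e) + [ nᵥ ] * exiting (b e) (a e)) + (zᵤ + zᵥ)
      ≡⟨ +-interchange ([ nᵤ ] * exiting (a e) (b e)) _ _ _ ⟩
    ([ nᵤ ] * exiting (a e) (b e) + zᵤ) + ([ nᵥ ] * exiting (b e) (a e) + zᵥ)
      ≤⟨ +-mono-≤ (endpoint-bound _ _ _ (proj₁ (exiting+coverage≡k e))) (endpoint-bound _ _ _ (proj₂ (exiting+coverage≡k e))) ⟩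
    [ coverage e ≡ᵇ 0 ] + [ coverage e ≡ᵇ 0 ]
      ≡⟨ cong ([ coverage e ≡ᵇ 0 ] +_) (+-identityʳ _) ⟨
    2 * [ coverage e ≡ᵇ 0 ] ∎
    where
    open ≤-Reasoning
    nᵤ nᵥ : Bool
    nᵤ = not (1 <ᵇ k (a e))
    nᵥ = not (1 <ᵇ k (b e))
    zᵤ zᵥ : ℕ
    zᵤ = [ k (a e) ≡ᵇ 0 ]
    zᵥ = [ k (b e) ≡ᵇ 0 ]

  boundary-count : D₁ + D₂ ≤ 2 * (∣ M ∣ + U)
  boundary-count = begin
    D₁ + D₂
      ≡⟨ cong₂ _+_ (∑ˢ-count 𝒴 leaving) (∑-weighted-degree G (λ v → [ k v ≡ᵇ 0 ])) ⟩
    sum (λ e → ∑ˢ (λ Y → [ 𝒴 Y ∧ leaving Y e ])) + sum (λ e → [ k (a e) ≡ᵇ 0 ] + [ k (b e) ≡ᵇ 0 ])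
      ≡⟨ ∑-distrib-+ (λ e → ∑ˢ (λ Y → [ 𝒴 Y ∧ leaving Y e ])) _ ⟨
    sum (λ e → ∑ˢ (λ Y → [ 𝒴 Y ∧ leaving Y e ]) + ([ k (a e) ≡ᵇ 0 ] + [ k (b e) ≡ᵇ 0 ]))
      ≤⟨ sum-mono-≤ (λ e → ≤-trans (boundary-edge e) (*-monoʳ-≤ 2 (uncovered-bound e))) ⟩
    sum (λ e → 2 * ([ lookup M e ] + [ lookup F e ] * [ coverage e ≡ᵇ 0 ]))
      ≡⟨ *-distribˡ-sum 2 (λ e → [ lookup M e ] + [ lookup F e ] * [ coverage e ≡ᵇ 0 ]) ⟨
    2 * sum (λ e → [ lookup M e ] + [ lookup F e ] * [ coverage e ≡ᵇ 0 ])
      ≡⟨ cong (2 *_) (trans (∑-distrib-+ ([_] ∘ lookup M) _) (cong (_+ U) (sym (∣p∣≡sum M)))) ⟩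
    2 * (∣ M ∣ + U) ∎
    where open ≤-Reasoning

  vertex-count : 2 * sumSingle ℓ ⊤ + T ≤ 2 * S + 2 * Z
  vertex-count = begin
    2 * sumSingle ℓ ⊤ + T
      ≡⟨ cong (λ x → 2 * x + T) (sumSingle-⊤ ℓ) ⟩
    2 * sum L + T
      ≡⟨ cong (_+ T) (*-distribˡ-sum 2 L) ⟩
    sum (λ v → 2 * L v) + T
      ≡⟨ ∑-distrib-+ (λ v → 2 * L v) _ ⟨
    sum (λ v → 2 * L v + L v * ([ 1 <ᵇ k v ] * k v))
      ≤⟨ sum-mono-≤ (λ v → vertex-bound (L v) (k v)) ⟩
    sum (λ v → 2 * (L v * k v) + 2 * ([ k v ≡ᵇ 0 ] * L v))
      ≡⟨ ∑-distrib-+ (λ v → 2 * (L v * k v)) _ ⟩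
    sum (λ v → 2 * (L v * k v)) + sum (λ v → 2 * ([ k v ≡ᵇ 0 ] * L v))
      ≡⟨ cong₂ _+_ (*-distribˡ-sum 2 (λ v → L v * k v)) (*-distribˡ-sum 2 (λ v → [ k v ≡ᵇ 0 ] * L v)) ⟨
    2 * S + 2 * Z ∎
    where open ≤-Reasoning

  σ⊤≤∣F∣+∣M∣ : sumSingle ℓ ⊤ ≤ ∣ F ∣ + ∣ M ∣
  σ⊤≤∣F∣+∣M∣ = *-cancelˡ-≤ 2 (+-cancelʳ-≤ T _ _ (begin
    2 * sumSingle ℓ ⊤ + T          ≤⟨ vertex-count ⟩
    2 * S + 2 * Z                  ≡⟨ cong (λ x → 2 * x + 2 * Z) tight-count ⟨
    2 * (C + K) + 2 * Z            ≡⟨ regroup₁ C K Z ⟩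
    2 * C + (2 * K + 2 * Z)        ≤⟨ +-monoʳ-≤ (2 * C) (+-mono-≤ separation-count degree-count) ⟩
    2 * C + (D₁ + T + D₂)          ≡⟨ regroup₂ C D₁ T D₂ ⟩
    2 * C + (D₁ + D₂) + T          ≤⟨ +-monoˡ-≤ T (+-monoʳ-≤ (2 * C) boundary-count) ⟩
    2 * C + 2 * (∣ M ∣ + U) + T    ≡⟨ cong (_+ T) (regroup₃ C ∣ M ∣ U) ⟩
    2 * (C + U + ∣ M ∣) + T        ≤⟨ +-monoˡ-≤ T (*-monoʳ-≤ 2 (+-monoˡ-≤ ∣ M ∣ spanned-count)) ⟩
    2 * (∣ F ∣ + ∣ M ∣) + T        ∎))
    where
    open ≤-Reasoning
    regroup₁ : ∀ c x z → 2 * (c + x) + 2 * z ≡ 2 * c + (2 * x + 2 * z)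
    regroup₁ = solve-∀
    regroup₂ : ∀ c d t d′ → 2 * c + (d + t + d′) ≡ 2 * c + (d + d′) + t
    regroup₂ = solve-∀
    regroup₃ : ∀ c μ u → 2 * c + 2 * (μ + u) ≡ 2 * (c + u + μ)
    regroup₃ = solve-∀

-- Saturated sparse sets

module Saturation
  (G : Graph) (ℓ : VSet G → ℕ)
  (supermodular : TwoIntersectingSupermodular ℓ)
  (degree : ∀ v → 2 * ℓ ⁅ v ⁆ ≤ dIn G ⊤ ⁅ v ⁆)
  (separation : ∀ (A B : VSet G) → (∀ x → x ∈ A → x ∉ B) → (∃ λ x → x ∉ (A ∪ B))
              → sumSingle ℓ (A ∪ B) < eIn G ⊤ (A ∪ B) + ℓ (A ∪ B)
              → 2 * ℓ (A ∪ B) ≤ dMinus G B A + sumSingle ℓ B)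
  (M : ESet G) (M-small : ∣ M ∣ ≤ ℓ ⊤)
  where

  open Sparsity G ℓ

  Overfull : VSet G → Set
  Overfull Y = σ Y < eIn G ⊤ Y + ℓ Y

  Saturated : ESet G → Set
  Saturated F = ∀ e → e ∉ M → e ∉ F → ∃ λ X → Tight F X × spans G X e ≡ true

  module Members (F : ESet G) (sparse : Sparse F) (saturated : Saturated F) (¬tight⊤ : ¬ Tight F ⊤) where

    member? : ∀ Y → Dec (MaximalTight F Y × Overfull Y)
    member? Y = maximalTight? F Y ×-dec (σ Y <? eIn G ⊤ Y + ℓ Y)

    𝒴 : VSet G → Bool
    𝒴 Y = isYes (member? Y)

    member : ∀ {Y} → 𝒴 Y ≡ true → MaximalTight F Y × Overfull Y
    member {Y} 𝒴Y = toWitness {a? = member? Y} (Equivalence.from Boolₚ.T-≡ 𝒴Y)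

    members-unique : ∀ e {Y Y′} → 𝒴 Y ≡ true → 𝒴 Y′ ≡ true → spans G Y e ≡ true → spans G Y′ e ≡ true → Y ≡ Y′
    members-unique e 𝒴Y 𝒴Y′ spansY spansY′ =
      maximalTight-unique supermodular F sparse (loopless G e) (proj₁ (member 𝒴Y)) (proj₁ (member 𝒴Y′))
        (spans⇒end₁∈ G e spansY) (spans⇒end₂∈ G e spansY) (spans⇒end₁∈ G e spansY′) (spans⇒end₂∈ G e spansY′)

    members-cover : ∀ e → lookup M e ≡ false → lookup F e ≡ false → ∃ λ Y → 𝒴 Y ≡ true × spans G Y e ≡ true
    members-cover e Me Fe with saturated e (lookup≡false⇒∉ Me) (lookup≡false⇒∉ Fe)
    ... | X , tX , spansX with tight⇒maximalTight F tX
    ...   | Y , X⊆Y , maximalY = Y , Equivalence.to Boolₚ.T-≡ (fromWitness {a? = member? Y} (maximalY , overfull)) , spansY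
      where
      spansY : spans G Y e ≡ true
      spansY = spans-mono G e X⊆Y spansX
      overfull : Overfull Y
      overfull = subst (_< eIn G ⊤ Y + ℓ Y) (proj₁ maximalY)
                       (+-monoˡ-< (ℓ Y) (eIn<eIn-⊤ G F Y e (lookup≡false⇒∉ Fe) spansY))

    members-separate : ∀ {Y} → 𝒴 Y ≡ true
                     → 2 * ℓ Y ≤ dMinus G (Y ∩ shared 𝒴) (Y ∩ ∁ (shared 𝒴)) + sumSingle ℓ (Y ∩ shared 𝒴)
    members-separate {Y} 𝒴Y = subst (λ W → 2 * ℓ W ≤ dMinus G B A + σ B) A∪B≡Y
      (separation A B disjoint (subst (λ W → ∃ λ x → x ∉ W) (sym A∪B≡Y) proper) overfull)
      where
      A B : VSet G
      A = Y ∩ ∁ (shared 𝒴)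
      B = Y ∩ shared 𝒴
      A∪B≡Y : A ∪ B ≡ Y
      A∪B≡Y = begin
        Y ∩ ∁ (shared 𝒴) ∪ Y ∩ shared 𝒴 ≡⟨ ∩-distribˡ-∪ Y (∁ (shared 𝒴)) (shared 𝒴) ⟨
        Y ∩ (∁ (shared 𝒴) ∪ shared 𝒴)   ≡⟨ cong (Y ∩_) (∪-inverseˡ (shared 𝒴)) ⟩
        Y ∩ ⊤                           ≡⟨ ∩-identityʳ Y ⟩
        Y                               ∎
        where open ≡-Reasoning
      overfull : Overfull (A ∪ B)
      overfull = subst Overfull (sym A∪B≡Y) (proj₂ (member 𝒴Y))
      disjoint : ∀ x → x ∈ A → x ∉ B
      disjoint x x∈A x∈B = x∈∁p⇒x∉p (proj₂ (x∈p∩q⁻ Y _ x∈A)) (proj₂ (x∈p∩q⁻ Y _ x∈B))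
      proper : ∃ λ x → x ∉ Y
      proper with any? (λ x → ¬? (x ∈? Y))
      ... | yes x∉Y = x∉Y
      ... | no ¬x∉Y = ⊥-elim (¬tight⊤ (subst (Tight F) Y≡⊤ (proj₁ (proj₁ (member 𝒴Y)))))
        where
        Y≡⊤ : Y ≡ ⊤
        Y≡⊤ = ⊆-antisym ⊆⊤ (λ {x} _ → decidable-stable (x ∈? Y) (λ x∉Y → ¬x∉Y (x , x∉Y)))

  saturated⇒tight⊤ : ∀ F → Sparse F → Saturated F → Tight F ⊤
  saturated⇒tight⊤ F sparse saturated with tight? F ⊤
  ... | yes tight⊤ = tight⊤
  ... | no ¬tight⊤ = ≤-antisym (sparse ⊤) (begin
    σ ⊤                   ≤⟨ Counting.σ⊤≤∣F∣+∣M∣ G ℓ F M 𝒴 (proj₁ ∘ proj₁ ∘ member)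
                               members-unique members-cover degree members-separate ⟩
    ∣ F ∣ + ∣ M ∣         ≤⟨ +-monoʳ-≤ ∣ F ∣ M-small ⟩
    ∣ F ∣ + ℓ ⊤           ≡⟨ cong (_+ ℓ ⊤) (eIn-⊤ G F) ⟨
    eIn G F ⊤ + ℓ ⊤       ∎)
    where
    open Members F sparse saturated ¬tight⊤
    open ≤-Reasoning

  Avoids : ESet G → Set
  Avoids F = ∀ e → e ∈ F → e ∉ M

  grow : ∀ d F → Sparse F → Avoids F → ∣ F ∣ + ℓ ⊤ + d ≡ σ ⊤
       → Σ (ESet G) λ F′ → Sparse F′ × Avoids F′ × ∣ F′ ∣ + ℓ ⊤ ≡ σ ⊤
  grow zero    F sparse avoids full = F , sparse , avoids , trans (sym (+-identityʳ _)) full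
  grow (suc d) F sparse avoids deficient
    with any? (λ e → ¬? (e ∈? M) ×-dec ¬? (e ∈? F) ×-dec sparse? (F ∪ ⁅ e ⁆))
  ... | yes (e , e∉M , e∉F , sparse′) = grow d (F ∪ ⁅ e ⁆) sparse′ avoids′ deficient′
    where
    avoids′ : Avoids (F ∪ ⁅ e ⁆)
    avoids′ f f∈F∪e with x∈p∪q⁻ F ⁅ e ⁆ f∈F∪e
    ... | inj₁ f∈F = avoids f f∈F
    ... | inj₂ f∈e rewrite x∈⁅y⁆⇒x≡y e f∈e = e∉M
    deficient′ : ∣ F ∪ ⁅ e ⁆ ∣ + ℓ ⊤ + d ≡ σ ⊤
    deficient′ = trans (cong (λ c → c + ℓ ⊤ + d) (∣p∪⁅x⁆∣≡1+∣p∣ e∉F)) (trans (sym (+-suc _ d)) deficient)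
  ... | no ¬extendable = ⊥-elim (m+1+n≢m (∣ F ∣ + ℓ ⊤) (trans deficient (sym full)))
    where
    saturated : Saturated F
    saturated e e∉M e∉F = blocked⇒spanned F sparse (λ sparse′ → ¬extendable (e , e∉M , e∉F , sparse′))
    full : ∣ F ∣ + ℓ ⊤ ≡ σ ⊤
    full = trans (cong (_+ ℓ ⊤) (sym (eIn-⊤ G F))) (saturated⇒tight⊤ F sparse saturated)

  sparse-basis : WeaklySubadditive ℓ → Σ (ESet G) λ F → Sparse F × Avoids F × ∣ F ∣ + ℓ ⊤ ≡ σ ⊤
  sparse-basis subadditive = grow (σ ⊤ ∸ ℓ ⊤) ⊥ (sparse-⊥ subadditive) (λ e e∈⊥ _ → ∉⊥ e∈⊥)
    (trans (cong (λ c → c + ℓ ⊤ + (σ ⊤ ∸ ℓ ⊤)) (∣⊥∣≡0 (m G))) (m+[n∸m]≡n (subadditive ⊤)))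

theorem3p3 : (G : Graph) (ℓ : VSet G → ℕ)
    → ℓ ⊥ ≡ 0
    → TwoIntersectingSupermodular ℓ
    → WeaklySubadditive ℓ
    → (∀ v → 2 * ℓ ⁅ v ⁆ ≤ dIn G ⊤ ⁅ v ⁆)
    → (∀ (A B : VSet G)
         → (∀ x → x ∈ A → x ∉ B)
         → (∃ λ x → x ∉ (A ∪ B))
         → sumSingle ℓ (A ∪ B) < eIn G ⊤ (A ∪ B) + ℓ (A ∪ B)
         → 2 * ℓ (A ∪ B) ≤ dMinus G B A + sumSingle ℓ B)
    → (M : ESet G)
    → ∣ M ∣ ≤ ℓ ⊤
    → Σ (ESet G) λ H → IsRigid G ℓ H × (∀ e → e ∈ H → e ∉ M)
theorem3p3 G ℓ _ supermodular subadditive degree separation M M-small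
  with Saturation.sparse-basis G ℓ supermodular degree separation M M-small subadditive
... | F , sparse , avoids , full =
  ∁ M , (F , (λ e∈F → x∉p⇒x∈∁p (avoids _ e∈F)) , sparse , full) , λ _ → x∈∁p⇒x∉p
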